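{- Fix an integer $s\ge 0$ and let $M$ be a $3\times3$ semi-magic square all of whose entries are at most $s$. Let $\mathbf a=(a_1,\dots,a_6)$ be the upshifted representative of $M$, let $m_1=\max(a_4,a_5,a_6)$ and $s_1=s-m_1$. Then $M^*=sJ-M$ is represented by the upshifted sextuple $$(s_1-a_1,\ s_1-a_2,\ s_1-a_3,\ m_1-a_4,\ m_1-a_5,\ m_1-a_6).$$
   Context: A semi-magic square of size 3 is a $3\times 3$ matrix with non-negative integer entries whose row sums and column sums all equal a common value (the line sum). $J$ is the $3\times3$ all-ones matrix. Fix the permutation matrices $P_1=I$, $P_2=\begin{bmatrix}0&0&1\\1&0&0\\0&1&0\end{bmatrix}$, $P_3=\begin{bmatrix}0&1&0\\0&0&1\\1&0&0\end{bmatrix}$, $P_4=\begin{bmatrix}0&0&1\\0&1&0\\1&0&0\end{bmatrix}$, $P_5=\begin{bmatrix}0&1&0\\1&0&0\\0&0&1\end{bmatrix}$, $P_6=\begin{bmatrix}1&0&0\\0&0&1\\0&1&0\end{bmatrix}$, so that $P_1+P_2+P_3=P_4+P_5+P_6=J$. A sextuple $\mathbf a$ of non-negative integers represents $M$ if $M=\sum_t a_tP_t$; every semi-magic square has such representatives, and two representatives of the same square differ by an integer multiple of $(1,1,1,-1,-1,-1)$. The upshifted representative of $M$ is the (unique) representing sextuple with $a_t=0$ for some $t\in\{4,5,6\}$. -}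

module Defs where

open import Data.Nat using (ℕ; _+_; _*_; _∸_; _⊔_; _≤_)
open import Data.Fin using (Fin; zero; suc)
open import Data.Vec using (Vec; []; _∷_; lookup)
open import Data.Product using (∃; _×_)
open import Data.Sum using (_⊎_)
open import Relation.Binary.PropositionalEquality using (_≡_)

Matrix : Set
Matrix = Fin 3 → Fin 3 → ℕ

-- sextuples (a₁,…,a₆) are indexed by Fin 6: index 0 ↔ a₁, …, index 5 ↔ a₆
Sextuple : Set
Sextuple = Fin 6 → ℕ

private
  fromRows : Vec (Vec ℕ 3) 3 → Matrix
  fromRows rows i j = lookup (lookup rows i) j

P : Fin 6 → Matrix
P zero = fromRows ((1 ∷ 0 ∷ 0 ∷ []) ∷ (0 ∷ 1 ∷ 0 ∷ []) ∷ (0 ∷ 0 ∷ 1 ∷ []) ∷ [])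
P (suc zero) = fromRows ((0 ∷ 0 ∷ 1 ∷ []) ∷ (1 ∷ 0 ∷ 0 ∷ []) ∷ (0 ∷ 1 ∷ 0 ∷ []) ∷ [])
P (suc (suc zero)) = fromRows ((0 ∷ 1 ∷ 0 ∷ []) ∷ (0 ∷ 0 ∷ 1 ∷ []) ∷ (1 ∷ 0 ∷ 0 ∷ []) ∷ [])
P (suc (suc (suc zero))) = fromRows ((0 ∷ 0 ∷ 1 ∷ []) ∷ (0 ∷ 1 ∷ 0 ∷ []) ∷ (1 ∷ 0 ∷ 0 ∷ []) ∷ [])
P (suc (suc (suc (suc zero)))) = fromRows ((0 ∷ 1 ∷ 0 ∷ []) ∷ (1 ∷ 0 ∷ 0 ∷ []) ∷ (0 ∷ 0 ∷ 1 ∷ []) ∷ [])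
P (suc (suc (suc (suc (suc zero))))) = fromRows ((1 ∷ 0 ∷ 0 ∷ []) ∷ (0 ∷ 0 ∷ 1 ∷ []) ∷ (0 ∷ 1 ∷ 0 ∷ []) ∷ [])

t₁ t₂ t₃ t₄ t₅ t₆ : Fin 6
t₁ = zero
t₂ = suc zero
t₃ = suc (suc zero)
t₄ = suc (suc (suc zero))
t₅ = suc (suc (suc (suc zero)))
t₆ = suc (suc (suc (suc (suc zero))))

i₁ i₂ i₃ : Fin 3
i₁ = zero
i₂ = suc zero
i₃ = suc (suc zero)

rowSum : Matrix → Fin 3 → ℕ
rowSum M i = M i i₁ + M i i₂ + M i i₃

colSum : Matrix → Fin 3 → ℕ
colSum M j = M i₁ j + M i₂ j + M i₃ j

SemiMagic : Matrix → Set
SemiMagic M = ∃ λ L → (∀ i → rowSum M i ≡ L) × (∀ j → colSum M j ≡ L)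

combo : Sextuple → Matrix
combo a i j = a t₁ * P t₁ i j + a t₂ * P t₂ i j + a t₃ * P t₃ i j
            + a t₄ * P t₄ i j + a t₅ * P t₅ i j + a t₆ * P t₆ i j

Represents : Sextuple → Matrix → Set
Represents a M = ∀ i j → M i j ≡ combo a i j

UpshiftedRep : Sextuple → Matrix → Set
UpshiftedRep a M = Represents a M × (a t₄ ≡ 0 ⊎ a t₅ ≡ 0 ⊎ a t₆ ≡ 0)

-- the complement M* = sJ − M (used only when all entries of M are ≤ s)
complement : ℕ → Matrix → Matrix
complement s M i j = s ∸ M i j

m₁ : Sextuple → ℕ
m₁ a = a t₄ ⊔ a t₅ ⊔ a t₆

-- the sextuple (s₁−a₁, s₁−a₂, s₁−a₃, m₁−a₄, m₁−a₅, m₁−a₆) with s₁ = s − m₁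
-- (truncated subtraction; non-negativity is asserted separately in the statement)
dualSextuple : ℕ → Sextuple → Sextuple
dualSextuple s a zero = (s ∸ m₁ a) ∸ a t₁
dualSextuple s a (suc zero) = (s ∸ m₁ a) ∸ a t₂
dualSextuple s a (suc (suc zero)) = (s ∸ m₁ a) ∸ a t₃
dualSextuple s a (suc (suc (suc zero))) = m₁ a ∸ a t₄
dualSextuple s a (suc (suc (suc (suc zero)))) = m₁ a ∸ a t₅
dualSextuple s a (suc (suc (suc (suc (suc zero))))) = m₁ a ∸ a t₆

-- Each cell of a 3×3 matrix lies on exactly one rotation Pₓ (x ≤ 3) and one transposition Pᵧ
-- (y ≥ 4), and each such pair Pₓ, Pᵧ meets in exactly one cell. So the entries of M are exactly
-- the sums aₓ + aᵧ; all are ≤ s, whence aₓ + m₁ ≤ s, and then every entry of sJ − M splits as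
-- s − (aₓ + aᵧ) = (s₁ − aₓ) + (m₁ − aᵧ) with both summands non-negative. The new sextuple is
-- upshifted because m₁ − aᵧ vanishes at a y where aᵧ is maximal.
module Submission where

open import Defs
open import Data.Nat using (ℕ; _+_; _*_; _∸_; _⊔_; _≤_)
open import Data.Nat.Properties
open import Data.Fin using (Fin; zero; suc)
open import Data.Product using (_×_; _,_)
open import Data.Sum using (_⊎_; inj₁; inj₂)
open import Relation.Binary.PropositionalEquality
open import Data.Nat.Tactic.RingSolver using (solve-∀)

+-⊔-lub : ∀ x {p q s} → x + p ≤ s → x + q ≤ s → x + (p ⊔ q) ≤ s
+-⊔-lub x {p} {q} x+p≤s x+q≤s =
  subst (_≤ _) (sym (+-distribˡ-⊔ x p q)) (⊔-lub x+p≤s x+q≤s)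

∸-+-split : ∀ {s m x y} → x + m ≤ s → y ≤ m → s ∸ (x + y) ≡ (s ∸ m ∸ x) + (m ∸ y)
∸-+-split {s} {m} {x} {y} x+m≤s y≤m = begin
  s ∸ (x + y)             ≡⟨ ∸-+-assoc s x y ⟨
  s ∸ x ∸ y               ≡⟨ cong (_∸ y) (m∸n+n≡m m≤s∸x) ⟨
  s ∸ x ∸ m + m ∸ y       ≡⟨ cong (λ z → z + m ∸ y) ∸-swap ⟨
  s ∸ m ∸ x + m ∸ y       ≡⟨ +-∸-assoc (s ∸ m ∸ x) y≤m ⟩
  s ∸ m ∸ x + (m ∸ y)     ∎
  where
  open ≡-Reasoning
  m≤s∸x : m ≤ s ∸ x
  m≤s∸x = m+n≤o⇒m≤o∸n m (subst (_≤ s) (+-comm x m) x+m≤s)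
  ∸-swap : s ∸ m ∸ x ≡ s ∸ x ∸ m
  ∸-swap = trans (∸-+-assoc s m x)
                 (trans (cong (s ∸_) (+-comm m x)) (sym (∸-+-assoc s x m)))

rotation transposition : Fin 3 → Fin 6
rotation zero = t₁
rotation (suc zero) = t₂
rotation (suc (suc zero)) = t₃
transposition zero = t₄
transposition (suc zero) = t₅
transposition (suc (suc zero)) = t₆

-- Cell (i , j) is a 1 of P (rotation (i − j)) and of P (transposition (2 − (i + j))), mod 3.
rotationAt transpositionAt : Fin 3 → Fin 3 → Fin 3
rotationAt zero zero = zero
rotationAt zero (suc zero) = suc (suc zero)
rotationAt zero (suc (suc zero)) = suc zero
rotationAt (suc zero) zero = suc zero
rotationAt (suc zero) (suc zero) = zero
rotationAt (suc zero) (suc (suc zero)) = suc (suc zero)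
rotationAt (suc (suc zero)) zero = suc (suc zero)
rotationAt (suc (suc zero)) (suc zero) = suc zero
rotationAt (suc (suc zero)) (suc (suc zero)) = zero
transpositionAt zero zero = suc (suc zero)
transpositionAt zero (suc zero) = suc zero
transpositionAt zero (suc (suc zero)) = zero
transpositionAt (suc zero) zero = suc zero
transpositionAt (suc zero) (suc zero) = zero
transpositionAt (suc zero) (suc (suc zero)) = suc (suc zero)
transpositionAt (suc (suc zero)) zero = zero
transpositionAt (suc (suc zero)) (suc zero) = suc (suc zero)
transpositionAt (suc (suc zero)) (suc (suc zero)) = suc zero

meeting : Fin 3 → Fin 3 → Fin 3 × Fin 3
meeting zero zero = i₂ , i₂
meeting zero (suc zero) = i₃ , i₃
meeting zero (suc (suc zero)) = i₁ , i₁
meeting (suc zero) zero = i₁ , i₃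
meeting (suc zero) (suc zero) = i₂ , i₁
meeting (suc zero) (suc (suc zero)) = i₃ , i₂
meeting (suc (suc zero)) zero = i₃ , i₁
meeting (suc (suc zero)) (suc zero) = i₁ , i₂
meeting (suc (suc zero)) (suc (suc zero)) = i₂ , i₃

meeting-correct : ∀ k l → let (i , j) = meeting k l in
                  rotationAt i j ≡ k × transpositionAt i j ≡ l
meeting-correct zero zero = refl , refl
meeting-correct zero (suc zero) = refl , refl
meeting-correct zero (suc (suc zero)) = refl , refl
meeting-correct (suc zero) zero = refl , refl
meeting-correct (suc zero) (suc zero) = refl , refl
meeting-correct (suc zero) (suc (suc zero)) = refl , refl
meeting-correct (suc (suc zero)) zero = refl , refl
meeting-correct (suc (suc zero)) (suc zero) = refl , refl
meeting-correct (suc (suc zero)) (suc (suc zero)) = refl , refl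

rotationPart transpositionPart : Sextuple → Matrix
rotationPart a i j = a t₁ * P t₁ i j + a t₂ * P t₂ i j + a t₃ * P t₃ i j
transpositionPart a i j = a t₄ * P t₄ i j + a t₅ * P t₅ i j + a t₆ * P t₆ i j

combo-split : ∀ a i j → combo a i j ≡ rotationPart a i j + transpositionPart a i j
combo-split a i j = regroup (a t₁ * P t₁ i j) (a t₂ * P t₂ i j) (a t₃ * P t₃ i j)
                            (a t₄ * P t₄ i j) (a t₅ * P t₅ i j) (a t₆ * P t₆ i j)
  where
  regroup : ∀ p q r u v w → p + q + r + u + v + w ≡ (p + q + r) + (u + v + w)
  regroup = solve-∀

select₁ : ∀ (f : Fin 6 → ℕ) {x y z} → f x * 1 + f y * 0 + f z * 0 ≡ f x
select₁ f {x} {y} {z} = lemma (f x) (f y) (f z)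
  where
  lemma : ∀ p q r → p * 1 + q * 0 + r * 0 ≡ p
  lemma = solve-∀

select₂ : ∀ (f : Fin 6 → ℕ) {x y z} → f x * 0 + f y * 1 + f z * 0 ≡ f y
select₂ f {x} {y} {z} = lemma (f x) (f y) (f z)
  where
  lemma : ∀ p q r → p * 0 + q * 1 + r * 0 ≡ q
  lemma = solve-∀

select₃ : ∀ (f : Fin 6 → ℕ) {x y z} → f x * 0 + f y * 0 + f z * 1 ≡ f z
select₃ f {x} {y} {z} = lemma (f x) (f y) (f z)
  where
  lemma : ∀ p q r → p * 0 + q * 0 + r * 1 ≡ r
  lemma = solve-∀

rotationPart-entry : ∀ a i j → rotationPart a i j ≡ a (rotation (rotationAt i j))
rotationPart-entry a zero zero = select₁ a
rotationPart-entry a zero (suc zero) = select₃ a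
rotationPart-entry a zero (suc (suc zero)) = select₂ a
rotationPart-entry a (suc zero) zero = select₂ a
rotationPart-entry a (suc zero) (suc zero) = select₁ a
rotationPart-entry a (suc zero) (suc (suc zero)) = select₃ a
rotationPart-entry a (suc (suc zero)) zero = select₃ a
rotationPart-entry a (suc (suc zero)) (suc zero) = select₂ a
rotationPart-entry a (suc (suc zero)) (suc (suc zero)) = select₁ a

transpositionPart-entry : ∀ a i j → transpositionPart a i j ≡ a (transposition (transpositionAt i j))
transpositionPart-entry a zero zero = select₃ a
transpositionPart-entry a zero (suc zero) = select₂ a
transpositionPart-entry a zero (suc (suc zero)) = select₁ a
transpositionPart-entry a (suc zero) zero = select₂ a
transpositionPart-entry a (suc zero) (suc zero) = select₁ a
transpositionPart-entry a (suc zero) (suc (suc zero)) = select₃ a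
transpositionPart-entry a (suc (suc zero)) zero = select₁ a
transpositionPart-entry a (suc (suc zero)) (suc zero) = select₃ a
transpositionPart-entry a (suc (suc zero)) (suc (suc zero)) = select₂ a

combo-entry : ∀ a i j →
  combo a i j ≡ a (rotation (rotationAt i j)) + a (transposition (transpositionAt i j))
combo-entry a i j =
  trans (combo-split a i j) (cong₂ _+_ (rotationPart-entry a i j) (transpositionPart-entry a i j))

transposition≤m₁ : ∀ a l → a (transposition l) ≤ m₁ a
transposition≤m₁ a zero = ≤-trans (m≤m⊔n (a t₄) (a t₅)) (m≤m⊔n (a t₄ ⊔ a t₅) (a t₆))
transposition≤m₁ a (suc zero) = ≤-trans (m≤n⊔m (a t₄) (a t₅)) (m≤m⊔n (a t₄ ⊔ a t₅) (a t₆))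
transposition≤m₁ a (suc (suc zero)) = m≤n⊔m (a t₄ ⊔ a t₅) (a t₆)

m₁-attained : ∀ a → m₁ a ∸ a t₄ ≡ 0 ⊎ m₁ a ∸ a t₅ ≡ 0 ⊎ m₁ a ∸ a t₆ ≡ 0
m₁-attained a with ⊔-sel (a t₄ ⊔ a t₅) (a t₆)
... | inj₂ m₁≡a₆ = inj₂ (inj₂ (m≤n⇒m∸n≡0 (≤-reflexive m₁≡a₆)))
... | inj₁ m₁≡a₄⊔a₅ with ⊔-sel (a t₄) (a t₅)
...   | inj₁ ≡a₄ = inj₁ (m≤n⇒m∸n≡0 (≤-reflexive (trans m₁≡a₄⊔a₅ ≡a₄)))
...   | inj₂ ≡a₅ = inj₂ (inj₁ (m≤n⇒m∸n≡0 (≤-reflexive (trans m₁≡a₄⊔a₅ ≡a₅))))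

dualSextuple-rotation : ∀ s a k → dualSextuple s a (rotation k) ≡ s ∸ m₁ a ∸ a (rotation k)
dualSextuple-rotation s a zero = refl
dualSextuple-rotation s a (suc zero) = refl
dualSextuple-rotation s a (suc (suc zero)) = refl

dualSextuple-transposition : ∀ s a l → dualSextuple s a (transposition l) ≡ m₁ a ∸ a (transposition l)
dualSextuple-transposition s a zero = refl
dualSextuple-transposition s a (suc zero) = refl
dualSextuple-transposition s a (suc (suc zero)) = refl

module _ {s : ℕ} {M : Matrix} (M≤s : ∀ i j → M i j ≤ s) (a : Sextuple) (a↦M : Represents a M) where

  rotation+transposition≤ : ∀ k l → a (rotation k) + a (transposition l) ≤ s
  rotation+transposition≤ k l with meeting k l | meeting-correct k l
  ... | i , j | refl , refl = subst (_≤ s) (trans (a↦M i j) (combo-entry a i j)) (M≤s i j)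

  rotation+m₁≤ : ∀ k → a (rotation k) + m₁ a ≤ s
  rotation+m₁≤ k = +-⊔-lub x (+-⊔-lub x (bound zero) (bound (suc zero))) (bound (suc (suc zero)))
    where
    x = a (rotation k)
    bound : ∀ l → x + a (transposition l) ≤ s
    bound = rotation+transposition≤ k

  dualSextuple-represents : Represents (dualSextuple s a) (complement s M)
  dualSextuple-represents i j = begin
    s ∸ M i j                                 ≡⟨ cong (s ∸_) (trans (a↦M i j) (combo-entry a i j)) ⟩
    s ∸ (a (rotation k) + a (transposition l))
      ≡⟨ ∸-+-split (rotation+m₁≤ k) (transposition≤m₁ a l) ⟩
    (s ∸ m₁ a ∸ a (rotation k)) + (m₁ a ∸ a (transposition l))
      ≡⟨ cong₂ _+_ (dualSextuple-rotation s a k) (dualSextuple-transposition s a l) ⟨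
    b (rotation k) + b (transposition l)     ≡⟨ combo-entry b i j ⟨
    combo b i j                               ∎
    where
    open ≡-Reasoning
    b = dualSextuple s a
    k = rotationAt i j
    l = transpositionAt i j

proposition4p1 : (s : ℕ) (M : Matrix) → SemiMagic M → (∀ i j → M i j ≤ s) →
    (a : Sextuple) → UpshiftedRep a M →
    (m₁ a ≤ s × a t₁ + m₁ a ≤ s × a t₂ + m₁ a ≤ s × a t₃ + m₁ a ≤ s)
    × UpshiftedRep (dualSextuple s a) (complement s M)
proposition4p1 s M _ M≤s a (a↦M , _) =
  (m+n≤o⇒n≤o (a t₁) (bound zero) , bound zero , bound (suc zero) , bound (suc (suc zero)))
  , dualSextuple-represents M≤s a a↦M , m₁-attained a
  where bound = rotation+m₁≤ M≤s a a↦M
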